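{- For every $n\geq 2$, the listings $\mathrm{LIST}_n$ and $\mathrm{REVLIST}_n$ of the spanning trees of $F_n$ can be generated in $O(1)$-amortized time per tree using $O(n)$ space.
   Context: For $n\ge 2$, the fan graph $F_n$ has vertices $v_2,\dots,v_n$ and $v_\infty$; its edges are $v_iv_{i+1}$ for $2\le i\le n-1$ and $v_iv_\infty$ for $2\le i\le n$. Let $P_n$ be the spanning tree that is the path $v_\infty, v_2, v_3,\dots,v_n$. The listings are defined using a global spanning tree $T$ of $F_n$, modified by operations "$T\leftarrow T-a+b$" (delete edge $a$, add edge $b$); "print $T$" appends $T$ to the listing. Procedure $\mathrm{Gen}(k,s_1,\mathit{varEdge})$: - If $k=2$: if $\mathit{varEdge}=1$, do $T\leftarrow T-v_2v_\infty+v_2v_3$ and print $T$. - If $k=3$: if $s_1=1$, then (if $\mathit{varEdge}=1$ do $T\leftarrow T-v_3v_2+v_3v_4$, otherwise do $T\leftarrow T-v_3v_2+v_3v_\infty$) and print $T$; then do $T\leftarrow T-v_2v_\infty+v_2v_3$ and print $T$. - If $k\ge4$: (i) if $s_1=1$: call $\mathrm{Gen}(k-1,1,0)$; then if $\mathit{varEdge}=1$ do $T\leftarrow T-v_kv_{k-1}+v_kv_{k+1}$, otherwise do $T\leftarrow T-v_kv_{k-1}+v_kv_\infty$; print $T$. (ii) Call $\mathrm{RevGen}(k-1,1,0)$; do $T\leftarrow T-v_{k-1}v_{k-2}+v_{k-1}v_k$; print $T$. (iii) Call $\mathrm{Gen}(k-2,1,1)$; if $k>4$ do $T\leftarrow T-v_{k-2}v_{k-1}+v_{k-2}v_\infty$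 and print $T$. (iv) Call $\mathrm{RevGen}(k-2,0,0)$. $\mathrm{RevGen}(k,s_1,\mathit{varEdge})$ performs the inverses of the (parameter-determined) sequence of operations of $\mathrm{Gen}(k,s_1,\mathit{varEdge})$ in reverse order, printing $T$ after each one. $\mathrm{LIST}_n$ is obtained by setting $T:=P_n$, printing $T$, and calling $\mathrm{Gen}(n,1,0)$. Let $L_n$ be its last tree. $\mathrm{REVLIST}_n$ is obtained by setting $T:=L_n$, printing $T$, and calling $\mathrm{RevGen}(n,1,0)$; it is $\mathrm{LIST}_n$ in reverse order. Each listing contains the $t_n$ spanning trees of $F_n$. Consecutive trees differ by removing one edge and adding another edge that shares an endpoint with it. -}

module Defs where

open import Data.Nat using (ℕ; zero; suc; _+_; _⊔_)
open import Data.Bool using (Bool; true; false; if_then_else_; _∧_; _∨_)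
open import Data.List using (List; []; _∷_; _++_; map; reverse; filter; foldl; scanl; length)
open import Data.Product using (_×_; _,_)
open import Relation.Nullary using (Dec; yes; no; ¬?)
open import Relation.Nullary.Decidable using (⌊_⌋)
import Data.Nat as N

-- The fan graph F_n: vertices v_i (i = 2..n) and v_∞.

data V : Set where
  v : ℕ → V
  ∞ : V

_==V_ : V → V → Bool
v i ==V v j = ⌊ i N.≟ j ⌋
v _ ==V ∞   = false
∞   ==V v _ = false
∞   ==V ∞   = true

-- An (undirected) edge, written as a pair of endpoints.
Edge : Set
Edge = V × V

_==E_ : Edge → Edge → Bool
(a , b) ==E (c , d) = ((a ==V c) ∧ (b ==V d)) ∨ ((a ==V d) ∧ (b ==V c))

Tree : Set
Tree = List Edge

-- An operation "T ← T - a + b" is the pair (a , b).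
Op : Set
Op = Edge × Edge

applyOp : Tree → Op → Tree
applyOp T (a , b) = b ∷ filter (λ e → ¬? (dec e)) T
  where
  open import Data.Bool using (T?)
  dec : (e : Edge) → Dec (Data.Bool.T (e ==E a))
  dec e = T? (e ==E a)

inv : Op → Op
inv (a , b) = (b , a)

pathFrom : ℕ → ℕ → List Edge
pathFrom i zero    = []
pathFrom i (suc c) = (v i , v (suc i)) ∷ pathFrom (suc i) c

P : ℕ → Tree
P n = (∞ , v 2) ∷ pathFrom 2 (n N.∸ 2)

-- A trace records: the sequence of operations performed (each followed by
-- "print T"), the running time (unit cost per procedure invocation and unit
-- cost per operation "T ← T - a + b; print T"), and the maximum depth of the
-- recursion stack (each frame holds O(1) words: k, s1, varEdge).

record Trace : Set where
  constructor trace
  field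
    ops   : List Op
    time  : ℕ
    depth : ℕ
open Trace public

empty : Trace
empty = trace [] 0 0

step : Op → Trace
step o = trace (o ∷ []) 1 0

_⊕_ : Trace → Trace → Trace
trace a t d ⊕ trace a' t' d' = trace (a ++ a') (t + t') (d ⊔ d')
infixr 5 _⊕_

frame : Trace → Trace
frame (trace a t d) = trace a (suc t) (suc d)

-- RevGen(k,s1,varEdge) executes the inverses of Gen(k,s1,varEdge)'s operations
-- in reverse order, via the mirrored recursion (same calls, same cost).
revT : Trace → Trace
revT (trace a t d) = trace (reverse (map inv a)) t d

gen : ℕ → Bool → Bool → Trace
gen zero s ve = frame empty
gen (suc zero) s ve = frame empty
gen (suc (suc zero)) s ve =
  frame (if ve then step ((v 2 , ∞) , (v 2 , v 3)) else empty)
gen (suc (suc (suc zero))) s ve =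
  frame ( (if s then step ((v 3 , v 2) , (if ve then (v 3 , v 4) else (v 3 , ∞))) else empty)
        ⊕ step ((v 2 , ∞) , (v 2 , v 3)))
gen (suc (suc (suc (suc m)))) s ve =
  frame ( (if s then gen (suc (suc (suc m))) true false
                       ⊕ step ((v k , v k-1) , (if ve then (v k , v (suc k)) else (v k , ∞)))
                else empty)
        ⊕ revT (gen (suc (suc (suc m))) true false)
        ⊕ step ((v k-1 , v k-2) , (v k-1 , v k))
        ⊕ gen (suc (suc m)) true true
        ⊕ (if ⌊ 1 N.≤? m ⌋ then step ((v k-2 , v k-1) , (v k-2 , ∞)) else empty)
        ⊕ revT (gen (suc (suc m)) false false))
  where
  k k-1 k-2 : ℕ
  k = suc (suc (suc (suc m)))
  k-1 = suc (suc (suc m))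
  k-2 = suc (suc m)

listing : Tree → List Op → List Tree
listing T₀ os = scanl applyOp T₀ os

LIST : ℕ → List Tree
LIST n = listing (P n) (ops (gen n true false))

L : ℕ → Tree
L n = foldl applyOp (P n) (ops (gen n true false))

REVLIST : ℕ → List Tree
REVLIST n = listing (L n) (ops (revT (gen n true false)))

-- Total time: initialising T (n edges, O(n)), printing it (1), and the call.
timeLIST timeREVLIST : ℕ → ℕ
timeLIST n    = n + suc (time (gen n true false))
timeREVLIST n = n + suc (time (revT (gen n true false)))

-- Space: the stored tree (n edges) plus the recursion stack.
spaceLIST spaceREVLIST : ℕ → ℕ
spaceLIST n    = n + depth (gen n true false)
spaceREVLIST n = n + depth (revT (gen n true false))

module Submission where

open import Defs
open import Data.Bool using (true; false; T; if_then_else_)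
open import Data.List using (length; []; _∷_; _++_; map; reverse)
open import Data.List.Properties using (length-++; length-map; length-reverse)
open import Data.Nat using (ℕ; zero; suc; _+_; _*_; _≤_; _<_; _≤ᵇ_; z≤n; s≤s)
open import Data.Nat.Properties
open import Algebra.Properties.CommutativeSemigroup +-commutativeSemigroup
  using (interchange)
open import Data.Nat.Tactic.RingSolver using (solve-∀)
open import Data.Product using (_×_; _,_; ∃-syntax)
open import Relation.Binary.PropositionalEquality
open import Relation.Nullary.Decidable using (⌊_⌋)

-- Charge every printed tree four units of time. Then each invocation of Gen
-- with k ≥ 3 pays for its own unit and hands two spare units back: for k = 3
-- it prints a tree itself, and for k ≥ 4 it prints one tree directly while the
-- spare units of RevGen(k − 1) and of Gen(k − 2, 1, 1) (which always prints)
-- also cover RevGen(k − 2, 0, 0), which prints nothing when k = 4.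
-- Gen(k) prints at least k − 2 trees, since it contains RevGen(k − 1) followed
-- by a print, so the O(n) initialisation of T is paid for as well. The
-- recursion is at most k + 1 frames deep, which gives O(n) space.

len : Trace → ℕ
len tr = length (ops tr)

len-⊕ : ∀ a b → len (a ⊕ b) ≡ len a + len b
len-⊕ a b = length-++ (ops a)

len-revT : ∀ a → len (revT a) ≡ len a
len-revT a = trans (length-reverse (map inv (ops a))) (length-map inv (ops a))

length-listing : ∀ T₀ os → length (listing T₀ os) ≡ suc (length os)
length-listing T₀ []       = refl
length-listing T₀ (o ∷ os) = cong suc (length-listing (applyOp T₀ o) os)

depth-if : ∀ {B} c A → depth A ≤ B → depth (if c then A else empty) ≤ B
depth-if true  A p = p
depth-if false A p = z≤n

depth-gen : ∀ k s ve → depth (gen k s ve) ≤ suc k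
depth-gen zero                         s     ve = ≤-refl
depth-gen (suc zero)                   s     ve = s≤s z≤n
depth-gen (suc (suc zero))             s     ve = s≤s (depth-if ve _ z≤n)
depth-gen (suc (suc (suc zero)))       s     ve = s≤s (⊔-lub (depth-if s _ z≤n) z≤n)
depth-gen (suc (suc (suc (suc m))))    s     ve = s≤s
  (⊔-lub (depth-if s _ (⊔-lub (depth-gen (suc (suc (suc m))) true false) z≤n))
  (⊔-lub (depth-gen (suc (suc (suc m))) true false)
  (⊔-lub z≤n
  (⊔-lub (m≤n⇒m≤1+n (depth-gen (suc (suc m)) true true))
  (⊔-lub (depth-if ⌊ 1 ≤? m ⌋ _ z≤n)
         (m≤n⇒m≤1+n (depth-gen (suc (suc m)) false false)))))))

len-gen-< : ∀ m s ve → len (gen (3 + m) true false) < len (gen (4 + m) s ve)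
len-gen-< m s ve = len-<-frame (gen (4 + m) s ve)
  (if s then gen (3 + m) true false ⊕ step _ else empty) (gen (3 + m) true false) refl
  where
  len-<-frame : ∀ t a g {o r} → t ≡ frame (a ⊕ revT g ⊕ step o ⊕ r) → len g < len t
  len-<-frame _ a g {o} {r} refl = begin-strict
    len g                             ≡⟨ len-revT g ⟨
    len (revT g)                      <⟨ m<m+n (len (revT g)) (s≤s z≤n) ⟩
    len (revT g) + len (step o ⊕ r)   ≡⟨ len-⊕ (revT g) (step o ⊕ r) ⟨
    len (revT g ⊕ step o ⊕ r)         ≤⟨ m≤n+m _ (len a) ⟩
    len a + len (revT g ⊕ step o ⊕ r) ≡⟨ len-⊕ a (revT g ⊕ step o ⊕ r) ⟨
    len (a ⊕ revT g ⊕ step o ⊕ r)     ∎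
    where open ≤-Reasoning

len-gen-≥ : ∀ j s ve → j ≤ len (gen (2 + j) s ve)
len-gen-≥ zero          s     ve = z≤n
len-gen-≥ (suc zero)    true  ve = s≤s z≤n
len-gen-≥ (suc zero)    false ve = s≤s z≤n
len-gen-≥ (suc (suc m)) s     ve = ≤-trans (s≤s (len-gen-≥ (suc m) true false)) (len-gen-< m s ve)

-- Four units of time per printed tree, plus y borrowed units, pay for the
-- run of tr and leave x units over. The record blocks reduction of x and y,
-- so that the combinators below infer them from their arguments.
record Amortised (x y : ℕ) (tr : Trace) : Set where
  constructor amortised
  field bound : time tr + x ≤ 4 * len tr + y
open Amortised

infixr 5 _⊕-amortised_
_⊕-amortised_ : ∀ {x₁ y₁ x₂ y₂ a b} →
  Amortised x₁ y₁ a → Amortised x₂ y₂ b → Amortised (x₁ + x₂) (y₁ + y₂) (a ⊕ b)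
_⊕-amortised_ {x₁} {y₁} {x₂} {y₂} {a} {b} (amortised p) (amortised q) = amortised (begin
  time a + time b + (x₁ + x₂)         ≡⟨ interchange (time a) (time b) x₁ x₂ ⟩
  time a + x₁ + (time b + x₂)         ≤⟨ +-mono-≤ p q ⟩
  4 * len a + y₁ + (4 * len b + y₂)   ≡⟨ interchange (4 * len a) y₁ (4 * len b) y₂ ⟩
  4 * len a + 4 * len b + (y₁ + y₂)   ≡⟨ cong (_+ (y₁ + y₂)) (*-distribˡ-+ 4 (len a) (len b)) ⟨
  4 * (len a + len b) + (y₁ + y₂)     ≡⟨ cong (λ l → 4 * l + (y₁ + y₂)) (len-⊕ a b) ⟨
  4 * len (a ⊕ b) + (y₁ + y₂)         ∎)
  where open ≤-Reasoning

revT-amortised : ∀ {x y a} → Amortised x y a → Amortised x y (revT a)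
revT-amortised {x} {y} {a} (amortised p) =
  amortised (subst (λ l → time a + x ≤ 4 * l + y) (sym (len-revT a)) p)

step-amortised : ∀ o → Amortised 3 0 (step o)
step-amortised o = amortised ≤-refl

empty-amortised : Amortised 0 0 empty
empty-amortised = amortised ≤-refl

-- The side condition is on closed numerals, so it is discharged by evaluation.
frame-amortised : ∀ {x y b} → Amortised x y b → {T (y + 3 ≤ᵇ x)} → Amortised 2 0 (frame b)
frame-amortised {x} {y} {b} (amortised p) {y+3≤ᵇx} = amortised (+-cancelʳ-≤ y _ _ (begin
  suc (time b) + 2 + y   ≡⟨ rearrange (time b) y ⟩
  time b + (y + 3)       ≤⟨ +-monoʳ-≤ (time b) (≤ᵇ⇒≤ (y + 3) x y+3≤ᵇx) ⟩
  time b + x             ≤⟨ p ⟩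
  4 * len b + y          ≡⟨ cong (_+ y) (+-identityʳ (4 * len b)) ⟨
  4 * len b + 0 + y      ∎))
  where
  open ≤-Reasoning
  rearrange : ∀ t y → suc t + 2 + y ≡ t + (y + 3)
  rearrange = solve-∀

weaken-amortised : ∀ {x x′ y y′ a} → x′ ≤ x → y ≤ y′ → Amortised x y a → Amortised x′ y′ a
weaken-amortised {a = a} x′≤x y≤y′ (amortised p) =
  amortised (≤-trans (+-monoʳ-≤ (time a) x′≤x) (≤-trans p (+-monoʳ-≤ (4 * len a) y≤y′)))

optional-amortised : ∀ c {x a} → Amortised x 0 a → Amortised 0 0 (if c then a else empty)
optional-amortised true  p = weaken-amortised z≤n ≤-refl p
optional-amortised false p = empty-amortised

amortised-gen≥3       : ∀ m s ve → Amortised 2 0 (gen (3 + m) s ve)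
amortised-gen-varEdge : ∀ m s → Amortised 2 0 (gen (2 + m) s true)
amortised-gen≥2       : ∀ m s ve → Amortised 0 1 (gen (2 + m) s ve)

amortised-gen≥3 zero    s ve = frame-amortised
  (optional-amortised s (step-amortised _) ⊕-amortised step-amortised _)
amortised-gen≥3 (suc m) s ve = frame-amortised
  (   optional-amortised s (amortised-gen≥3 m true false ⊕-amortised step-amortised _)
  ⊕-amortised revT-amortised (amortised-gen≥3 m true false)
  ⊕-amortised step-amortised _
  ⊕-amortised amortised-gen-varEdge m true
  ⊕-amortised optional-amortised ⌊ 1 ≤? m ⌋ (step-amortised _)
  ⊕-amortised revT-amortised (amortised-gen≥2 m false false))

amortised-gen-varEdge zero    s = amortised ≤-refl
amortised-gen-varEdge (suc m) s = amortised-gen≥3 m s true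

amortised-gen≥2 zero    s true  = amortised (s≤s (s≤s z≤n))
amortised-gen≥2 zero    s false = amortised ≤-refl
amortised-gen≥2 (suc m) s ve    = weaken-amortised z≤n z≤n (amortised-gen≥3 m s ve)

time-gen≥2 : ∀ m s ve → time (gen (2 + m) s ve) ≤ 4 * len (gen (2 + m) s ve) + 1
time-gen≥2 m s ve = ≤-trans (m≤m+n _ 0) (bound (amortised-gen≥2 m s ve))

time-bound : ∀ {j t l} → j ≤ l → t ≤ 4 * l + 1 → 2 + j + suc t ≤ 5 * suc l
time-bound {j} {t} {l} j≤l t≤4l+1 = begin
  2 + j + suc t                ≤⟨ +-mono-≤ (+-monoʳ-≤ 2 j≤l) (s≤s t≤4l+1) ⟩
  2 + l + suc (4 * l + 1)      ≤⟨ n≤1+n _ ⟩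
  suc (2 + l + suc (4 * l + 1)) ≡⟨ rearrange l ⟩
  5 * suc l                    ∎
  where
  open ≤-Reasoning
  rearrange : ∀ l → suc (2 + l + suc (4 * l + 1)) ≡ 5 * suc l
  rearrange = solve-∀

space-bound : ∀ {n d} → 1 ≤ n → d ≤ suc n → n + d ≤ 5 * n
space-bound {n} {d} 1≤n d≤1+n = +-monoʳ-≤ n (begin
  d             ≤⟨ d≤1+n ⟩
  1 + n         ≤⟨ +-monoˡ-≤ n 1≤n ⟩
  n + n         ≤⟨ +-monoʳ-≤ n (m≤m+n n _) ⟩
  4 * n         ∎)
  where open ≤-Reasoning

timeLIST-bound : ∀ j → timeLIST (2 + j) ≤ 5 * length (LIST (2 + j))
timeLIST-bound j = begin
  timeLIST (2 + j)         ≤⟨ time-bound (len-gen-≥ j true false) (time-gen≥2 j true false) ⟩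
  5 * suc (len g)          ≡⟨ cong (5 *_) (length-listing (P (2 + j)) (ops g)) ⟨
  5 * length (LIST (2 + j)) ∎
  where
  open ≤-Reasoning
  g : Trace
  g = gen (2 + j) true false

timeREVLIST-bound : ∀ j → timeREVLIST (2 + j) ≤ 5 * length (REVLIST (2 + j))
timeREVLIST-bound j = begin
  timeREVLIST (2 + j)          ≤⟨ time-bound (len-gen-≥ j true false) (time-gen≥2 j true false) ⟩
  5 * suc (len g)              ≡⟨ cong (λ l → 5 * suc l) (len-revT g) ⟨
  5 * suc (len (revT g))       ≡⟨ cong (5 *_) (length-listing (L (2 + j)) (ops (revT g))) ⟨
  5 * length (REVLIST (2 + j)) ∎
  where
  open ≤-Reasoning
  g : Trace
  g = gen (2 + j) true false

spaceLIST-bound : ∀ j → spaceLIST (2 + j) ≤ 5 * (2 + j)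
spaceLIST-bound j = space-bound (s≤s z≤n) (depth-gen (2 + j) true false)

theorem2 : ∃[ c ] (∀ (n : ℕ) → 2 ≤ n →
             (timeLIST n ≤ c * length (LIST n))
           × (timeREVLIST n ≤ c * length (REVLIST n))
           × (spaceLIST n ≤ c * n)
           × (spaceREVLIST n ≤ c * n))
theorem2 = 5 , λ where
  (suc (suc j)) (s≤s (s≤s z≤n)) →
    timeLIST-bound j , timeREVLIST-bound j , spaceLIST-bound j , spaceLIST-bound j
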